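{- Let $\mathfrak X$ be a homogeneous tree of degree $q+1$ ($q\geq1$) and let $f_0,f_1\in\mathcal F(\mathfrak X)$. Then there is a unique wave $\{f_k\}_{k\in\mathbb Z}$ on $\mathfrak X$ with the given snapshots $f_0,f_1$, and it is given by $$f_k=U_{k-1}(\mu_1)f_1-U_{k-2}(\mu_1)f_0,\qquad k\in\mathbb Z.$$
   Context: $\mathfrak X$ is a tree in which every vertex has exactly $q+1$ edges; $\mathcal F(\mathfrak X)$ is the space of complex-valued functions on its vertices; $\mu_1f(v)=\frac{1}{q+1}\sum_{w\text{ adjacent to }v}f(w)$. A wave is a family $\{f_k\}_{k\in\mathbb Z}$ in $\mathcal F(\mathfrak X)$ with $\mu_1f_k=\frac{f_{k+1}+f_{k-1}}{2}$ for all $k\in\mathbb Z$; $f_k$ is the snapshot at time $k$. $U_n$ are Chebyshev polynomials of the second kind: $U_0=1$, $U_1(x)=2x$, $U_k(x)=2xU_{k-1}(x)-U_{k-2}(x)$, extended to negative indices by $U_{ -n-1}=-U_{n-1}$ for $n\geq0$ (so $U_{ -1}=0$, $U_{ -2}=-1$, and the recursion holds for all $k\in\mathbb Z$). For a polynomial $P$, $P(\mu_1)$ denotes the corresponding polynomial in the operator $\mu_1$. -}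

module Defs where


open import Data.Nat as ℕ using (ℕ; zero; suc)
open import Data.Fin using (Fin; zero; suc)
open import Data.Fin.Properties using (_≟_)
open import Data.List using (List; []; _∷_)
open import Data.Product using (Σ; _,_; _×_; proj₁; proj₂)
open import Data.Unit using (⊤; tt)
open import Data.Integer as ℤ using (ℤ; +_; -[1+_])
open import Relation.Nullary using (¬_; yes; no)
open import Relation.Binary.PropositionalEquality using (_≡_)
open import Algebra.Bundles using (CommutativeRing)

-- The homogeneous tree of degree n (= q+1): the Cayley graph of the free
-- product of n copies of Z/2, i.e. reduced words over the alphabet Fin n
-- (no two consecutive letters equal).  Vertex w is adjacent to the
-- n vertices  step a w  (a : Fin n), which are pairwise distinct.

Reduced : ∀ {n} → List (Fin n) → Set
Reduced [] = ⊤
Reduced (a ∷ []) = ⊤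
Reduced (a ∷ b ∷ w) = (¬ a ≡ b) × Reduced (b ∷ w)

reduced-tail : ∀ {n} (b : Fin n) (w : List (Fin n)) → Reduced (b ∷ w) → Reduced w
reduced-tail b [] r = tt
reduced-tail b (c ∷ w) r = proj₂ r

Vertex : ℕ → Set
Vertex n = Σ (List (Fin n)) Reduced

step : ∀ {n} → Fin n → Vertex n → Vertex n
step a ([] , r) = (a ∷ []) , tt
step a ((b ∷ w) , r) with a ≟ b
... | yes _ = w , reduced-tail b w r
... | no a≢b = (a ∷ b ∷ w) , (a≢b , r)

-- Functions on the tree with values in a commutative ring R (standing in
-- for ℂ), in which 2 and q+1 are invertible (inverses inv2, invq1).

module Wave {c ℓ} (R : CommutativeRing c ℓ) (q : ℕ)
            (inv2 invq1 : CommutativeRing.Carrier R) where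
  open CommutativeRing R hiding (zero)

  X : Set
  X = Vertex (suc q)

  F : Set c
  F = X → Carrier

  _≋_ : F → F → Set ℓ
  f ≋ g = ∀ v → f v ≈ g v

  sumFin : ∀ {n} → (Fin n → Carrier) → Carrier
  sumFin {zero} h = 0#
  sumFin {suc n} h = h zero + sumFin (λ i → h (suc i))

  μ₁ : F → F
  μ₁ f v = invq1 * sumFin (λ a → f (step a v))

  _⊕_ : F → F → F
  (f ⊕ g) v = f v + g v

  _⊖_ : F → F → F
  (f ⊖ g) v = f v - g v

  ⊝_ : F → F
  (⊝ f) v = - f v

  0F : F
  0F v = 0#

  Uℕ : ℕ → F → F
  Uℕ zero f = f
  Uℕ (suc zero) f = μ₁ f ⊕ μ₁ f
  Uℕ (suc (suc n)) f = (μ₁ (Uℕ (suc n) f) ⊕ μ₁ (Uℕ (suc n) f)) ⊖ Uℕ n f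

  -- U_k(μ₁) for k ∈ ℤ, with U_{-n-1} = -U_{n-1} (so U_{-1} = 0).
  U : ℤ → F → F
  U (+ n) f = Uℕ n f
  U -[1+ zero ] f = 0F
  U -[1+ suc n ] f = ⊝ (Uℕ n f)

  IsWave : (ℤ → F) → Set ℓ
  IsWave f = ∀ k → μ₁ (f k) ≋ (λ v → inv2 * (f (k ℤ.+ ℤ.1ℤ) v + f (k ℤ.- ℤ.1ℤ) v))

  formula : F → F → ℤ → F
  formula f₀ f₁ k = U (k ℤ.- ℤ.1ℤ) f₁ ⊖ U (k ℤ.- + 2) f₀

{-# OPTIONS --safe #-}
-- Once 2 is invertible, the wave equation says f_{k+1} = 2μ₁ f_k − f_{k−1}: a
-- three-term recurrence that can be solved forwards and backwards in k, so a wave is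
-- determined by two consecutive snapshots. The Chebyshev polynomials obey the same
-- recurrence in their index, on all of ℤ thanks to the convention U_{−n−1} = −U_{n−1};
-- since μ₁ is additive, so do the shifted families k ↦ U_{k−1}(μ₁) f₁, k ↦ U_{k−2}(μ₁) f₀
-- and their difference, whose snapshots at k = 0 and k = 1 are f₀ and f₁.
module Submission where

open import Defs
open import Data.Nat as ℕ using (ℕ; zero; suc; _≥_)
import Data.Nat.Properties as ℕₚ
open import Data.Integer using (ℤ; 0ℤ; 1ℤ; +_; +[1+_]; -[1+_])
import Data.Integer as ℤ
open import Data.Integer.Tactic.RingSolver using (solve-∀)
open import Data.Fin using (Fin; zero; suc)
open import Data.Product using (_×_; _,_; proj₁)
open import Relation.Binary.PropositionalEquality as ≡ using (_≡_)
open import Algebra.Bundles using (CommutativeRing; Ring)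

ℤ-induction₂ : ∀ {p} (P : ℤ → Set p) → P 0ℤ → P 1ℤ →
               (∀ k → P (k ℤ.- 1ℤ) → P k → P (k ℤ.+ 1ℤ)) →
               (∀ k → P (k ℤ.+ 1ℤ) → P k → P (k ℤ.- 1ℤ)) →
               ∀ k → P k
ℤ-induction₂ P P0 P1 forward backward = λ where
    (+ n)    → proj₁ (upward n)
    -[1+ n ] → proj₁ (downward n)
  where
  upward : ∀ n → P (+ n) × P +[1+ n ]
  upward zero    = P0 , P1
  upward (suc n) with upward n
  ... | Pn , P1+n =
    P1+n , ≡.subst P (≡.cong +[1+_] (ℕₚ.+-comm n 1)) (forward +[1+ n ] Pn P1+n)

  downward : ∀ n → P -[1+ n ] × P (-[1+ n ] ℤ.+ 1ℤ)
  downward zero    = backward 0ℤ P1 P0 , P0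
  downward (suc n) with downward n
  ... | P-1-n , P-n =
    ≡.subst P (≡.cong (λ m → -[1+ suc m ]) (ℕₚ.+-identityʳ n)) (backward -[1+ n ] P-n P-1-n) ,
    P-1-n

module RingSubtraction {c ℓ} (R : Ring c ℓ) where
  open Ring R
  open import Algebra.Properties.Ring R
  open import Algebra.Properties.CommutativeSemigroup +-commutativeSemigroup using (interchange)
  open import Relation.Binary.Reasoning.Setoid setoid

  x-0≈x : ∀ x → x - 0# ≈ x
  x-0≈x x = trans (+-congˡ -0#≈0#) (+-identityʳ x)

  0--x≈x : ∀ x → 0# - - x ≈ x
  0--x≈x x = trans (+-identityˡ (- - x)) (-‿involutive x)

  x≈y-z⇒z≈y-x : ∀ {x y z} → x ≈ y - z → z ≈ y - x
  x≈y-z⇒z≈y-x {x} {y} {z} x≈y-z = x≈z//y z x y (begin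
    z + x        ≈⟨ +-comm z x ⟩
    x + z        ≈⟨ +-congʳ x≈y-z ⟩
    (y - z) + z  ≈⟨ //-rightDividesˡ z y ⟩
    y            ∎)

  [x-y]+[x-y]≈[x+x]-[y+y] : ∀ x y → (x - y) + (x - y) ≈ (x + x) - (y + y)
  [x-y]+[x-y]≈[x+x]-[y+y] x y = trans (interchange x (- y) x (- y)) (+-congˡ (-‿+-comm y y))

  [x-y]-[z-w]≈[x-z]-[y-w] : ∀ x y z w → (x - y) - (z - w) ≈ (x - z) - (y - w)
  [x-y]-[z-w]≈[x-z]-[y-w] x y z w = begin
    (x - y) + - (z - w)      ≈⟨ +-congˡ (-‿+-comm z (- w)) ⟨
    (x - y) + (- z + - - w)  ≈⟨ interchange x (- y) (- z) (- - w) ⟩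
    (x - z) + (- y + - - w)  ≈⟨ +-congˡ (-‿+-comm y (- w)) ⟩
    (x - z) - (y - w)        ∎

module WaveEquation {c ℓ} (R : CommutativeRing c ℓ) (q : ℕ)
                    (inv2 invq1 : CommutativeRing.Carrier R) where
  open CommutativeRing R hiding (zero)
  open Wave R q inv2 invq1
  open RingSubtraction ring
  open import Algebra.Properties.Ring ring using (-‿+-comm; -0#≈0#; -‿distribʳ-*; x≈z//y; //-rightDividesˡ)
  open import Algebra.Properties.CommutativeSemigroup +-commutativeSemigroup using (interchange)
  open import Relation.Binary.Reasoning.Setoid setoid

  ≋-sym : ∀ {f g} → f ≋ g → g ≋ f
  ≋-sym f≋g v = sym (f≋g v)

  ≋-trans : ∀ {f g h} → f ≋ g → g ≋ h → f ≋ h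
  ≋-trans f≋g g≋h v = trans (f≋g v) (g≋h v)

  sumFin-cong : ∀ {n} (g h : Fin n → Carrier) → (∀ i → g i ≈ h i) → sumFin g ≈ sumFin h
  sumFin-cong {zero}  g h g≈h = refl
  sumFin-cong {suc n} g h g≈h =
    +-cong (g≈h zero) (sumFin-cong (λ i → g (suc i)) (λ i → h (suc i)) (λ i → g≈h (suc i)))

  sumFin-+ : ∀ {n} (g h : Fin n → Carrier) → sumFin (λ i → g i + h i) ≈ sumFin g + sumFin h
  sumFin-+ {zero}  g h = sym (+-identityʳ 0#)
  sumFin-+ {suc n} g h =
    trans (+-congˡ (sumFin-+ (λ i → g (suc i)) (λ i → h (suc i)))) (interchange _ _ _ _)

  sumFin-neg : ∀ {n} (h : Fin n → Carrier) → sumFin (λ i → - h i) ≈ - sumFin h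
  sumFin-neg {zero}  h = sym -0#≈0#
  sumFin-neg {suc n} h = trans (+-congˡ (sumFin-neg (λ i → h (suc i)))) (-‿+-comm _ _)

  sumFin-0 : ∀ n → sumFin {n} (λ _ → 0#) ≈ 0#
  sumFin-0 zero    = refl
  sumFin-0 (suc n) = trans (+-identityˡ _) (sumFin-0 n)

  neighbours : F → X → Fin (suc q) → Carrier
  neighbours f v a = f (step a v)

  μ₁-cong : ∀ {f g} → f ≋ g → μ₁ f ≋ μ₁ g
  μ₁-cong {f} {g} f≋g v =
    *-congˡ (sumFin-cong (neighbours f v) (neighbours g v) (λ a → f≋g (step a v)))

  μ₁-⊕-homo : ∀ f g → μ₁ (f ⊕ g) ≋ (μ₁ f ⊕ μ₁ g)
  μ₁-⊕-homo f g v = trans (*-congˡ (sumFin-+ (neighbours f v) (neighbours g v))) (distribˡ invq1 _ _)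

  μ₁-⊝-homo : ∀ f → μ₁ (⊝ f) ≋ (⊝ μ₁ f)
  μ₁-⊝-homo f v = trans (*-congˡ (sumFin-neg (neighbours f v))) (sym (-‿distribʳ-* invq1 _))

  μ₁-0F-homo : μ₁ 0F ≋ 0F
  μ₁-0F-homo v = trans (*-congˡ (sumFin-0 (suc q))) (zeroʳ invq1)

  2μ₁ : F → F
  2μ₁ f = μ₁ f ⊕ μ₁ f

  2μ₁-cong : ∀ {f g} → f ≋ g → 2μ₁ f ≋ 2μ₁ g
  2μ₁-cong f≋g v = +-cong (μ₁-cong f≋g v) (μ₁-cong f≋g v)

  2μ₁-⊖-homo : ∀ f g → 2μ₁ (f ⊖ g) ≋ (2μ₁ f ⊖ 2μ₁ g)
  2μ₁-⊖-homo f g v = trans (+-cong μ₁f-g μ₁f-g) ([x-y]+[x-y]≈[x+x]-[y+y] _ _)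
    where
    μ₁f-g : μ₁ (f ⊖ g) v ≈ μ₁ f v - μ₁ g v
    μ₁f-g = trans (μ₁-⊕-homo f (⊝ g) v) (+-congˡ (μ₁-⊝-homo g v))

  2μ₁-⊝-homo : ∀ f → 2μ₁ (⊝ f) ≋ (⊝ 2μ₁ f)
  2μ₁-⊝-homo f v = trans (+-cong (μ₁-⊝-homo f v) (μ₁-⊝-homo f v)) (-‿+-comm _ _)

  2μ₁-0F-homo : 2μ₁ 0F ≋ 0F
  2μ₁-0F-homo v = trans (+-cong (μ₁-0F-homo v) (μ₁-0F-homo v)) (+-identityʳ 0#)

  three-term-reverse : ∀ {f h} g → f ≋ (2μ₁ g ⊖ h) → h ≋ (2μ₁ g ⊖ f)
  three-term-reverse g f≋2μ₁g-h v = x≈y-z⇒z≈y-x (f≋2μ₁g-h v)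

  three-term-⊝ : ∀ {f h} g → f ≋ (2μ₁ g ⊖ h) → (⊝ f) ≋ (2μ₁ (⊝ g) ⊖ (⊝ h))
  three-term-⊝ {f} {h} g f≋2μ₁g-h v = begin
    - f v                  ≈⟨ -‿cong (f≋2μ₁g-h v) ⟩
    - (2μ₁ g v - h v)      ≈⟨ -‿+-comm (2μ₁ g v) (- h v) ⟨
    - 2μ₁ g v - - h v      ≈⟨ +-congʳ (2μ₁-⊝-homo g v) ⟨
    2μ₁ (⊝ g) v - - h v    ∎

  Recurrent : (ℤ → F) → Set ℓ
  Recurrent a = ∀ k → a (k ℤ.+ 1ℤ) ≋ (2μ₁ (a k) ⊖ a (k ℤ.- 1ℤ))

  recurrent-backward : ∀ {a} → Recurrent a → ∀ k → a (k ℤ.- 1ℤ) ≋ (2μ₁ (a k) ⊖ a (k ℤ.+ 1ℤ))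
  recurrent-backward {a} rec k = three-term-reverse (a k) (rec k)

  recurrent-⊖ : ∀ {a b} → Recurrent a → Recurrent b → Recurrent (λ k → a k ⊖ b k)
  recurrent-⊖ {a} {b} recᵃ recᵇ k v = begin
    a (k ℤ.+ 1ℤ) v - b (k ℤ.+ 1ℤ) v                     ≈⟨ +-cong (recᵃ k v) (-‿cong (recᵇ k v)) ⟩
    (2μ₁ (a k) v - a k₋ v) - (2μ₁ (b k) v - b k₋ v)     ≈⟨ [x-y]-[z-w]≈[x-z]-[y-w] _ _ _ _ ⟩
    (2μ₁ (a k) v - 2μ₁ (b k) v) - (a k₋ v - b k₋ v)     ≈⟨ +-congʳ (2μ₁-⊖-homo (a k) (b k) v) ⟨
    2μ₁ (a k ⊖ b k) v - (a k₋ v - b k₋ v)               ∎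
    where
    k₋ : ℤ
    k₋ = k ℤ.- 1ℤ

  recurrent-shift : ∀ {a} → Recurrent a → ∀ j → Recurrent (λ k → a (k ℤ.- j))
  recurrent-shift {a} rec j k v = begin
    a ((k ℤ.+ 1ℤ) ℤ.- j) v                        ≡⟨ ≡.cong (λ i → a i v) (+1-shift k j) ⟩
    a ((k ℤ.- j) ℤ.+ 1ℤ) v                        ≈⟨ rec (k ℤ.- j) v ⟩
    2μ₁ (a (k ℤ.- j)) v - a ((k ℤ.- j) ℤ.- 1ℤ) v  ≡⟨ ≡.cong (λ i → 2μ₁ (a (k ℤ.- j)) v - a i v) (-1-shift k j) ⟨
    2μ₁ (a (k ℤ.- j)) v - a ((k ℤ.- 1ℤ) ℤ.- j) v  ∎
    where
    +1-shift : ∀ k j → (k ℤ.+ 1ℤ) ℤ.- j ≡ (k ℤ.- j) ℤ.+ 1ℤ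
    +1-shift = solve-∀
    -1-shift : ∀ k j → (k ℤ.- 1ℤ) ℤ.- j ≡ (k ℤ.- j) ℤ.- 1ℤ
    -1-shift = solve-∀

  recurrent-unique : ∀ {a b} → Recurrent a → Recurrent b →
                     a 0ℤ ≋ b 0ℤ → a 1ℤ ≋ b 1ℤ → ∀ k → a k ≋ b k
  recurrent-unique {a} {b} recᵃ recᵇ a₀≋b₀ a₁≋b₁ =
    ℤ-induction₂ (λ k → a k ≋ b k) a₀≋b₀ a₁≋b₁ forward backward
    where
    recurrence-cong : ∀ {i j} → a i ≋ b i → a j ≋ b j → (2μ₁ (a i) ⊖ a j) ≋ (2μ₁ (b i) ⊖ b j)
    recurrence-cong aᵢ≋bᵢ aⱼ≋bⱼ v = +-cong (2μ₁-cong aᵢ≋bᵢ v) (-‿cong (aⱼ≋bⱼ v))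

    forward : ∀ k → a (k ℤ.- 1ℤ) ≋ b (k ℤ.- 1ℤ) → a k ≋ b k → a (k ℤ.+ 1ℤ) ≋ b (k ℤ.+ 1ℤ)
    forward k a₋≋b₋ aₖ≋bₖ =
      ≋-trans (recᵃ k) (≋-trans (recurrence-cong aₖ≋bₖ a₋≋b₋) (≋-sym (recᵇ k)))

    backward : ∀ k → a (k ℤ.+ 1ℤ) ≋ b (k ℤ.+ 1ℤ) → a k ≋ b k → a (k ℤ.- 1ℤ) ≋ b (k ℤ.- 1ℤ)
    backward k a₊≋b₊ aₖ≋bₖ =
      ≋-trans (recurrent-backward {a} recᵃ k)
        (≋-trans (recurrence-cong aₖ≋bₖ a₊≋b₊) (≋-sym (recurrent-backward {b} recᵇ k)))

  Uℕ-recurrent : ∀ f n → Uℕ (suc n) f ≋ (2μ₁ (U (+ n) f) ⊖ U (+ n ℤ.- 1ℤ) f)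
  Uℕ-recurrent f zero    v = sym (x-0≈x (2μ₁ f v))
  Uℕ-recurrent f (suc n) v = refl

  U-reflect : ∀ f n → U -[1+ n ] f ≋ (⊝ U (+ n ℤ.- 1ℤ) f)
  U-reflect f zero    v = sym -0#≈0#
  U-reflect f (suc n) v = refl

  U-recurrent : ∀ f → Recurrent (λ k → U k f)
  U-recurrent f (+ n) v = begin
    Uℕ (n ℕ.+ 1) f v                            ≡⟨ ≡.cong (λ m → Uℕ m f v) (ℕₚ.+-comm n 1) ⟩
    Uℕ (suc n) f v                              ≈⟨ Uℕ-recurrent f n v ⟩
    (2μ₁ (U (+ n) f) ⊖ U (+ n ℤ.- 1ℤ) f) v      ∎
  U-recurrent f -[1+ zero ] v = begin
    f v                        ≈⟨ 0--x≈x (f v) ⟨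
    0# - - f v                 ≈⟨ +-congʳ (2μ₁-0F-homo v) ⟨
    2μ₁ 0F v - - f v           ∎
  U-recurrent f -[1+ suc n ] v = begin
    U -[1+ n ] f v                             ≈⟨ U-reflect f n v ⟩
    - U (+ n ℤ.- 1ℤ) f v                       ≈⟨ three-term-⊝ (Uℕ n f) reversed v ⟩
    2μ₁ (⊝ Uℕ n f) v - - Uℕ (suc n) f v        ≡⟨ ≡.cong (λ m → 2μ₁ (⊝ Uℕ n f) v - - Uℕ (suc m) f v)
                                                          (ℕₚ.+-identityʳ n) ⟨
    2μ₁ (⊝ Uℕ n f) v - - Uℕ (suc n ℕ.+ 0) f v  ∎
    where
    reversed : U (+ n ℤ.- 1ℤ) f ≋ (2μ₁ (Uℕ n f) ⊖ Uℕ (suc n) f)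
    reversed = three-term-reverse (Uℕ n f) (Uℕ-recurrent f n)

  formula-recurrent : ∀ f₀ f₁ → Recurrent (formula f₀ f₁)
  formula-recurrent f₀ f₁ =
    recurrent-⊖ {λ k → U (k ℤ.- 1ℤ) f₁} {λ k → U (k ℤ.- + 2) f₀}
      (recurrent-shift {λ k → U k f₁} (U-recurrent f₁) 1ℤ)
      (recurrent-shift {λ k → U k f₀} (U-recurrent f₀) (+ 2))

  formula-0 : ∀ f₀ f₁ → formula f₀ f₁ 0ℤ ≋ f₀
  formula-0 f₀ f₁ v = 0--x≈x (f₀ v)

  formula-1 : ∀ f₀ f₁ → formula f₀ f₁ 1ℤ ≋ f₁
  formula-1 f₀ f₁ v = x-0≈x (f₁ v)

  module _ (inv2*2≈1 : inv2 * (1# + 1#) ≈ 1#) where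

    half-double : ∀ x → inv2 * (x + x) ≈ x
    half-double x = begin
      inv2 * (x + x)            ≈⟨ *-congˡ (+-cong (*-identityˡ x) (*-identityˡ x)) ⟨
      inv2 * (1# * x + 1# * x)  ≈⟨ *-congˡ (distribʳ x 1# 1#) ⟨
      inv2 * ((1# + 1#) * x)    ≈⟨ *-assoc inv2 (1# + 1#) x ⟨
      inv2 * (1# + 1#) * x      ≈⟨ *-congʳ inv2*2≈1 ⟩
      1# * x                    ≈⟨ *-identityˡ x ⟩
      x                         ∎

    wave⇒recurrent : ∀ {a} → IsWave a → Recurrent a
    wave⇒recurrent {a} wave k v = x≈z//y (a (k ℤ.+ 1ℤ) v) (a (k ℤ.- 1ℤ) v) (2μ₁ (a k) v) (begin
      a (k ℤ.+ 1ℤ) v + a (k ℤ.- 1ℤ) v  ≈⟨ half-double _ ⟨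
      inv2 * (s + s)                   ≈⟨ distribˡ inv2 s s ⟩
      inv2 * s + inv2 * s              ≈⟨ +-cong (wave k v) (wave k v) ⟨
      2μ₁ (a k) v                      ∎)
      where
      s : Carrier
      s = a (k ℤ.+ 1ℤ) v + a (k ℤ.- 1ℤ) v

    recurrent⇒wave : ∀ {a} → Recurrent a → IsWave a
    recurrent⇒wave {a} rec k v = begin
      μ₁ (a k) v                                  ≈⟨ half-double _ ⟨
      inv2 * 2μ₁ (a k) v                          ≈⟨ *-congˡ (//-rightDividesˡ aₖ₋₁ _) ⟨
      inv2 * (2μ₁ (a k) v - aₖ₋₁ + aₖ₋₁)          ≈⟨ *-congˡ (+-congʳ (rec k v)) ⟨
      inv2 * (a (k ℤ.+ 1ℤ) v + aₖ₋₁)              ∎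
      where
      aₖ₋₁ : Carrier
      aₖ₋₁ = a (k ℤ.- 1ℤ) v

    formula-wave : ∀ f₀ f₁ → IsWave (formula f₀ f₁)
    formula-wave f₀ f₁ = recurrent⇒wave {formula f₀ f₁} (formula-recurrent f₀ f₁)

    wave-unique : ∀ {g} f₀ f₁ → IsWave g → g 0ℤ ≋ f₀ → g 1ℤ ≋ f₁ → ∀ k → g k ≋ formula f₀ f₁ k
    wave-unique {g} f₀ f₁ g-wave g₀≋f₀ g₁≋f₁ =
      recurrent-unique {g} {formula f₀ f₁} (wave⇒recurrent {g} g-wave) (formula-recurrent f₀ f₁)
        (≋-trans g₀≋f₀ (≋-sym (formula-0 f₀ f₁))) (≋-trans g₁≋f₁ (≋-sym (formula-1 f₀ f₁)))

theorem3p1 : ∀ {c ℓ} (R : CommutativeRing c ℓ) (q : ℕ) → q ≥ 1 →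
    (inv2 invq1 : CommutativeRing.Carrier R) →
    CommutativeRing._≈_ R (CommutativeRing._*_ R inv2 (CommutativeRing._+_ R (CommutativeRing.1# R) (CommutativeRing.1# R))) (CommutativeRing.1# R) →
    CommutativeRing._≈_ R (CommutativeRing._*_ R invq1 (Wave.sumFin R q inv2 invq1 {suc q} (λ _ → CommutativeRing.1# R))) (CommutativeRing.1# R) →
    let open Wave R q inv2 invq1 in
    (f₀ f₁ : F) →
      (IsWave (formula f₀ f₁) × formula f₀ f₁ 0ℤ ≋ f₀ × formula f₀ f₁ 1ℤ ≋ f₁)
      × (∀ (g : ℤ → F) → IsWave g → g 0ℤ ≋ f₀ → g 1ℤ ≋ f₁ → ∀ k → g k ≋ formula f₀ f₁ k)
theorem3p1 R q _ inv2 invq1 inv2*2≈1 _ f₀ f₁ =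
  (formula-wave inv2*2≈1 f₀ f₁ , formula-0 f₀ f₁ , formula-1 f₀ f₁) ,
  λ g → wave-unique inv2*2≈1 f₀ f₁
  where open WaveEquation R q inv2 invq1
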